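{- A function $f\in\mathcal{F}_{m+k}$ is regular bent if and only if its rectangle $R_f$ (defined in the context) is bent, i.e. if and only if for every fixed $\vec{v}\in V_k$ there exists $h_{\vec v}\in\mathcal{F}_m$ such that $q^{(m-k)/2}R_f(\vec{u},\vec{v})=\widehat{h_{\vec v}}(\vec{u})$ for all $\vec{u}\in V_m$.
   Context: Let $q\ge 2$ be an integer, $\mathbb{Z}_q=\{0,1,\ldots,q-1\}$ the ring of integers modulo $q$, and $\chi(a)=\exp(2\pi i a/q)$ for $a\in\mathbb{Z}_q$. Let $V_n=\mathbb{Z}_q^n$ and let $\mathcal{F}_n$ be the set of all functions $V_n\to\mathbb{Z}_q$ (for $n=0$, $\mathcal{F}_0$ consists of the constant functions $c$, whose Walsh–Hadamard transform is the constant $\chi(c)$). For $f\in\mathcal{F}_n$ its Walsh–Hadamard transform is $\widehat{f}(\vec{u})=\sum_{\vec{x}\in V_n}\chi(f(\vec{x}))\overline{\chi(\vec{u}\cdot\vec{x})}$, $\vec u\in V_n$. A function $f\in\mathcal{F}_n$ is regular bent if for all $\vec{u}\in V_n$, $|\widehat{f}(\vec{u})|=q^{n/2}$ and $\widehat{f}(\vec{u})\in q^{n/2}\{\zeta\in\mathbb{C}:\zeta^q=1\}$. For nonnegative integers $m,k$ and $f\in\mathcal{F}_{m+k}$, the rectangle of $f$ is $R_f(\vec{u},\vec{v})=\sum_{\vec{y}\in V_k}\chi(f(\vec{u},\vec{y}))\overline{\chi(\vec{v}\cdot\vec{y})}$, $\vec{u}\in V_m$, $\vec{v}\in V_k$;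 for each fixed $\vec u$, the map $\vec v\mapsto R_f(\vec u,\vec v)$ is automatically the Walsh–Hadamard transform of a function in $\mathcal F_k$. The rectangle is called bent if additionally, for each fixed $\vec v$, the map $\vec u\mapsto q^{(m-k)/2}R_f(\vec u,\vec v)$ is the Walsh–Hadamard transform of some function in $\mathcal{F}_m$. -}

module Defs where

open import Level using (_⊔_)
open import Data.Nat as ℕ using (ℕ; zero; suc; _≤_; _<_)
open import Data.Fin using (Fin; toℕ)
open import Data.Vec using (Vec; []; _∷_; _++_)
open import Data.Integer as ℤ using (ℤ; +_; -[1+_])
open import Data.Product using (Σ; _×_)
open import Data.Sum using (_⊎_)
open import Relation.Nullary using (¬_)
open import Algebra.Bundles using (CommutativeRing)

-- Z_q is represented by Fin q, V_n = Z_q^n by Vec (Fin q) n.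
V : ℕ → ℕ → Set
V q n = Vec (Fin q) n

𝓕 : ℕ → ℕ → Set
𝓕 q n = V q n → Fin q

-- The complex numbers are replaced by an arbitrary commutative ring R
-- (required below to have no zero divisors), ζ plays exp(2πi/q),
-- s plays q^{1/2} and sinv its inverse.
module Ring {c ℓ} (R : CommutativeRing c ℓ) where
  open CommutativeRing R

  pow : Carrier → ℕ → Carrier
  pow x zero = 1#
  pow x (suc n) = x * pow x n

  fromℕ : ℕ → Carrier
  fromℕ zero = 0#
  fromℕ (suc n) = 1# + fromℕ n

  NoZeroDivisors : Set (c ⊔ ℓ)
  NoZeroDivisors = ∀ x y → x * y ≈ 0# → (x ≈ 0#) ⊎ (y ≈ 0#)

  PrimitiveRoot : ℕ → Carrier → Set ℓ
  PrimitiveRoot q ζ = (pow ζ q ≈ 1#) × (∀ b → 0 < b → b < q → ¬ (pow ζ b ≈ 1#))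

  sumFin : ∀ {q} → (Fin q → Carrier) → Carrier
  sumFin {zero} F = 0#
  sumFin {suc q} F = F Fin.zero + sumFin {q} (λ i → F (Fin.suc i))

  sumV : ∀ {q} n → (V q n → Carrier) → Carrier
  sumV zero F = F []
  sumV {q} (suc n) F = sumFin {q} (λ a → sumV n (λ x → F (a ∷ x)))

  -- dot product u · x, computed in ℕ (only its residue mod q matters)
  dot : ∀ {q n} → V q n → V q n → ℕ
  dot [] [] = 0
  dot (a ∷ u) (b ∷ x) = toℕ a ℕ.* toℕ b ℕ.+ dot u x

  module Chars (q : ℕ) (ζ s sinv : Carrier) where

    χ : ℕ → Carrier
    χ t = pow ζ t

    -- conj(χ(t)) = ζ^{-t} = ζ^{(q-1) t}
    χ̄ : ℕ → Carrier
    χ̄ t = pow ζ ((q ℕ.∸ 1) ℕ.* t)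

    qhalf : ℤ → Carrier
    qhalf (+ n) = pow s n
    qhalf -[1+ n ] = pow sinv (suc n)

    walsh : ∀ n → 𝓕 q n → V q n → Carrier
    walsh n f u = sumV n (λ x → χ (toℕ (f x)) * χ̄ (dot u x))

    -- regular bent: every f̂(u) lies in q^{n/2} μ_q (this implies |f̂(u)| = q^{n/2})
    RegularBent : ∀ n → 𝓕 q n → Set ℓ
    RegularBent n f = ∀ (u : V q n) → Σ (Fin q) λ j → walsh n f u ≈ qhalf (+ n) * χ (toℕ j)

    rect : ∀ m k → 𝓕 q (m ℕ.+ k) → V q m → V q k → Carrier
    rect m k f u v = sumV k (λ y → χ (toℕ (f (u ++ y))) * χ̄ (dot v y))

    -- bent rectangle (the first condition, that v ↦ R_f(u,v) is a Walsh
    -- transform for each u, holds automatically)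
    RectangleBent : ∀ m k → 𝓕 q (m ℕ.+ k) → Set ℓ
    RectangleBent m k f = ∀ (v : V q k) → Σ (𝓕 q m) λ h →
      ∀ (u : V q m) → qhalf (+ m ℤ.- + k) * rect m k f u v ≈ walsh m h u

module Submission where

open import Defs
open import Data.Nat using (ℕ; _≤_; _+_)
open import Function.Bundles using (_⇔_)
open import Algebra.Bundles using (CommutativeRing)

open import Function.Bundles using (mk⇔)
open import Function.Base using (_∘_)
import Data.Nat as ℕ
import Data.Nat.Properties as ℕP
open import Data.Nat using (zero; suc; _<_; s≤s; z≤n)
open import Data.Fin as F using (Fin; toℕ)
import Data.Fin.Properties as FP
open import Data.Vec using ([]; _∷_; _++_; map; splitAt)
open import Data.Integer as ℤ using (+_)
import Data.Integer.Properties as ℤP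
open import Data.Product using (_,_; proj₁; proj₂)
open import Data.Sum using (_⊎_; inj₁; inj₂)
open import Data.Empty using (⊥-elim)
open import Relation.Nullary using (¬_; Dec; yes; no)
open import Relation.Binary.Definitions using (tri<; tri≈; tri>)
open import Relation.Binary.PropositionalEquality as P using (_≡_)
open import Data.Maybe using (nothing)
open import Tactic.RingSolver using (solve-∀)
open import Tactic.RingSolver.Core.AlmostCommutativeRing
  using (AlmostCommutativeRing; fromCommutativeRing)
import Data.Nat.Tactic.RingSolver as ℕSolver

-- Write  T F (w) = Σ_u F(u) χ̄(w·u)  for the unnormalised
-- Walsh transform on V_m, so that  ĥ = T (χ ∘ h).  Splitting the sum that
-- defines f̂ along V_{m+k} = V_m × V_k gives
--      f̂(u',v) = T (u ↦ R_f(u,v)) (u').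
-- By orthogonality of characters T is invertible, T (T F) (w) = q^m F(-w).
-- Hence, for fixed v, the column q^{(m-k)/2} R_f(·,v) equals ĥ = T (χ ∘ h)
-- exactly when its transform q^{(m-k)/2} f̂(·,v) equals T (T (χ ∘ h)) =
-- q^m χ(h(-·)); since q^{(m-k)/2} q^{(m+k)/2} = q^m, this says precisely
-- that f̂(u',v) = q^{(m+k)/2} χ(h(-u')) lies in q^{(m+k)/2} μ_q.

-- Commutative-ring identities, discharged by the ring solver (which needs
-- the operations of its own ring bundle, hence the separate module).
module Identities {c ℓ} (R : CommutativeRing c ℓ) where
  solverRing : AlmostCommutativeRing c ℓ
  solverRing = fromCommutativeRing R (λ _ → nothing)
  open AlmostCommutativeRing solverRing using (_≈_; _*_) renaming (_+_ to _⊕_)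

  telescope-expand : ∀ z g o → z * (o ⊕ z * g) ⊕ o ≈ z * (z * g ⊕ o) ⊕ o
  telescope-expand = solve-∀ solverRing

  telescope-regroup : ∀ z g p o → z * (g ⊕ p) ⊕ o ≈ (o ⊕ z * g) ⊕ z * p
  telescope-regroup = solve-∀ solverRing

-- The exponent identity behind  χ̄(a t) χ̄(t b) = χ̄(a + b)^t.
exponent-regroup : ∀ n a t b → n ℕ.* (a ℕ.* t + t ℕ.* b) ≡ (n ℕ.* (a + b)) ℕ.* t
exponent-regroup = ℕSolver.solve-∀

module Algebraic {c ℓ} (R : CommutativeRing c ℓ) where
  open CommutativeRing R renaming (_+_ to _⊕_)
  open Ring R using (pow; fromℕ; sumFin; sumV; NoZeroDivisors)
  open import Relation.Binary.Reasoning.Setoid setoid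
  open import Algebra.Properties.Semiring.Sum semiring
    using (sum; sum-cong-≋; ∑-distrib-+; *-distribˡ-sum; *-distribʳ-sum; sum-replicate-zero)
  open import Algebra.Properties.CommutativeSemiring.Exp commutativeSemiring
    using (_^_; ^-congˡ; ^-homo-*; ^-assocʳ; ^-distrib-*)
  open import Algebra.Properties.Ring ring using (+-cancelʳ; [y-z]x≈yx-zx; x∙y⁻¹≈ε⇒x≈y; x≈y⇒x∙y⁻¹≈ε)
  open import Algebra.Properties.CommutativeSemigroup *-commutativeSemigroup using (x∙yz≈xz∙y)
  open Identities R using (telescope-expand; telescope-regroup)

  -- `pow` is the library's `_^_`, which supplies the exponent laws.
  pow≡^ : ∀ x n → pow x n ≡ x ^ n
  pow≡^ x zero = P.refl
  pow≡^ x (suc n) = P.cong (x *_) (pow≡^ x n)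

  pow-≡ : ∀ x {a b} → a ≡ b → pow x a ≈ pow x b
  pow-≡ x e = reflexive (P.cong (pow x) e)

  pow-cong : ∀ {x y} n → x ≈ y → pow x n ≈ pow y n
  pow-cong {x} {y} n e rewrite pow≡^ x n | pow≡^ y n = ^-congˡ n e

  pow-+ : ∀ x a b → pow x (a + b) ≈ pow x a * pow x b
  pow-+ x a b rewrite pow≡^ x (a + b) | pow≡^ x a | pow≡^ x b = ^-homo-* x a b

  pow-* : ∀ x a b → pow x (a ℕ.* b) ≈ pow (pow x a) b
  pow-* x a b rewrite pow≡^ x (a ℕ.* b) | pow≡^ x a | pow≡^ (x ^ a) b = sym (^-assocʳ x a b)

  pow-distrib : ∀ x y n → pow (x * y) n ≈ pow x n * pow y n
  pow-distrib x y n rewrite pow≡^ (x * y) n | pow≡^ x n | pow≡^ y n = ^-distrib-* x y n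

  pow-1# : ∀ n → pow 1# n ≈ 1#
  pow-1# zero = refl
  pow-1# (suc n) = trans (*-identityˡ _) (pow-1# n)

  pow-unit : ∀ {i a} n → i * a ≈ 1# → pow i n * pow a n ≈ 1#
  pow-unit {i} {a} n ia = trans (sym (pow-distrib i a n)) (trans (pow-cong n ia) (pow-1# n))

  unit-cancelˡ : ∀ {i a x y} → i * a ≈ 1# → a * x ≈ a * y → x ≈ y
  unit-cancelˡ {i} {a} {x} {y} ia e = begin
    x           ≈⟨ sym (*-identityˡ x) ⟩
    1# * x      ≈⟨ *-congʳ (sym ia) ⟩
    (i * a) * x ≈⟨ *-assoc i a x ⟩
    i * (a * x) ≈⟨ *-congˡ e ⟩
    i * (a * y) ≈⟨ sym (*-assoc i a y) ⟩
    (i * a) * y ≈⟨ *-congʳ ia ⟩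
    1# * y      ≈⟨ *-identityˡ y ⟩
    y           ∎

  -- `sumFin` is the library's `sum`, which supplies linearity.
  sumFin≡sum : ∀ {n} (F : Fin n → Carrier) → sumFin F ≡ sum F
  sumFin≡sum {zero} F = P.refl
  sumFin≡sum {suc n} F = P.cong (F F.zero ⊕_) (sumFin≡sum (F ∘ F.suc))

  sumFin-cong : ∀ {n} {F G : Fin n → Carrier} → (∀ i → F i ≈ G i) → sumFin F ≈ sumFin G
  sumFin-cong {F = F} {G} e rewrite sumFin≡sum F | sumFin≡sum G = sum-cong-≋ e

  sumFin-+ : ∀ {n} (F G : Fin n → Carrier) → sumFin (λ i → F i ⊕ G i) ≈ sumFin F ⊕ sumFin G
  sumFin-+ F G rewrite sumFin≡sum (λ i → F i ⊕ G i) | sumFin≡sum F | sumFin≡sum G = ∑-distrib-+ F G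

  sumFin-*ˡ : ∀ {n} x (F : Fin n → Carrier) → sumFin (λ i → x * F i) ≈ x * sumFin F
  sumFin-*ˡ x F rewrite sumFin≡sum (λ i → x * F i) | sumFin≡sum F = sym (*-distribˡ-sum x F)

  sumFin-*ʳ : ∀ {n} x (F : Fin n → Carrier) → sumFin (λ i → F i * x) ≈ sumFin F * x
  sumFin-*ʳ x F rewrite sumFin≡sum (λ i → F i * x) | sumFin≡sum F = sym (*-distribʳ-sum x F)

  sumFin-0# : ∀ n → sumFin {n} (λ _ → 0#) ≈ 0#
  sumFin-0# n rewrite sumFin≡sum {n} (λ _ → 0#) = sum-replicate-zero n

  sumFin-1# : ∀ n → sumFin {n} (λ _ → 1#) ≈ fromℕ n
  sumFin-1# zero = refl
  sumFin-1# (suc n) = +-congˡ (sumFin-1# n)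

  module _ {q : ℕ} where
    sumV-cong : ∀ m {F G : V q m → Carrier} → (∀ x → F x ≈ G x) → sumV m F ≈ sumV m G
    sumV-cong zero e = e []
    sumV-cong (suc m) e = sumFin-cong (λ a → sumV-cong m (λ x → e (a ∷ x)))

    sumV-+ : ∀ m (F G : V q m → Carrier) → sumV m (λ x → F x ⊕ G x) ≈ sumV m F ⊕ sumV m G
    sumV-+ zero F G = refl
    sumV-+ (suc m) F G = trans (sumFin-cong (λ a → sumV-+ m (F ∘ (a ∷_)) (G ∘ (a ∷_))))
      (sumFin-+ (λ a → sumV m (F ∘ (a ∷_))) (λ a → sumV m (G ∘ (a ∷_))))

    sumV-*ˡ : ∀ m x (F : V q m → Carrier) → sumV m (λ y → x * F y) ≈ x * sumV m F
    sumV-*ˡ zero x F = refl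
    sumV-*ˡ (suc m) x F = trans (sumFin-cong (λ a → sumV-*ˡ m x (F ∘ (a ∷_))))
      (sumFin-*ˡ x (λ a → sumV m (F ∘ (a ∷_))))

    sumV-*ʳ : ∀ m x (F : V q m → Carrier) → sumV m (λ y → F y * x) ≈ sumV m F * x
    sumV-*ʳ zero x F = refl
    sumV-*ʳ (suc m) x F = trans (sumFin-cong (λ a → sumV-*ʳ m x (F ∘ (a ∷_))))
      (sumFin-*ʳ x (λ a → sumV m (F ∘ (a ∷_))))

    sumV-0# : ∀ m → sumV m (λ (_ : V q m) → 0#) ≈ 0#
    sumV-0# zero = refl
    sumV-0# (suc m) = trans (sumFin-cong {q} (λ _ → sumV-0# m)) (sumFin-0# q)

    sumFin-sumV-comm : ∀ {n} k (F : Fin n → V q k → Carrier) →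
      sumFin (λ a → sumV k (F a)) ≈ sumV k (λ y → sumFin (λ a → F a y))
    sumFin-sumV-comm {zero} k F = sym (sumV-0# k)
    sumFin-sumV-comm {suc n} k F = trans (+-congˡ (sumFin-sumV-comm k (F ∘ F.suc)))
      (sym (sumV-+ k (F F.zero) (λ y → sumFin (λ a → F (F.suc a) y))))

    sumV-comm : ∀ m k (F : V q m → V q k → Carrier) →
      sumV m (λ x → sumV k (F x)) ≈ sumV k (λ y → sumV m (λ x → F x y))
    sumV-comm zero k F = refl
    sumV-comm (suc m) k F = trans (sumFin-cong (λ a → sumV-comm m k (F ∘ (a ∷_))))
      (sumFin-sumV-comm k (λ a y → sumV m (λ x → F (a ∷ x) y)))

    sumV-++ : ∀ m k (F : V q (m + k) → Carrier) →
      sumV (m + k) F ≈ sumV m (λ u → sumV k (λ y → F (u ++ y)))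
    sumV-++ zero k F = refl
    sumV-++ (suc m) k F = sumFin-cong (λ a → sumV-++ m k (F ∘ (a ∷_)))

  δ : ∀ {n} → Fin n → Fin n → Carrier
  δ F.zero F.zero = 1#
  δ F.zero (F.suc _) = 0#
  δ (F.suc _) F.zero = 0#
  δ (F.suc i) (F.suc j) = δ i j

  δ-refl : ∀ {n} (a : Fin n) → δ a a ≈ 1#
  δ-refl F.zero = refl
  δ-refl (F.suc a) = δ-refl a

  δ-distinct : ∀ {n} (a b : Fin n) → ¬ a ≡ b → δ a b ≈ 0#
  δ-distinct F.zero F.zero a≢b = ⊥-elim (a≢b P.refl)
  δ-distinct F.zero (F.suc b) a≢b = refl
  δ-distinct (F.suc a) F.zero a≢b = refl
  δ-distinct (F.suc a) (F.suc b) a≢b = δ-distinct a b (a≢b ∘ P.cong F.suc)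

  δV : ∀ {q m} → V q m → V q m → Carrier
  δV [] [] = 1#
  δV (a ∷ x) (b ∷ y) = δ a b * δV x y

  sift : ∀ {n} (H : Fin n → Carrier) (c : Fin n) → sumFin (λ t → H t * δ t c) ≈ H c
  sift {suc n} H F.zero = begin
    H F.zero * 1# ⊕ sumFin (λ t → H (F.suc t) * 0#)
      ≈⟨ +-cong (*-identityʳ _) (trans (sumFin-cong (λ t → zeroʳ (H (F.suc t)))) (sumFin-0# n)) ⟩
    H F.zero ⊕ 0# ≈⟨ +-identityʳ _ ⟩
    H F.zero ∎
  sift {suc n} H (F.suc c) = trans (+-cong (zeroʳ _) (sift (H ∘ F.suc) c)) (+-identityˡ _)

  siftV : ∀ {q} m (G : V q m → Carrier) (c : V q m) → sumV m (λ x → G x * δV x c) ≈ G c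
  siftV zero G [] = *-identityʳ _
  siftV (suc m) G (c₀ ∷ c) = begin
    sumFin (λ t → sumV m (λ x → G (t ∷ x) * (δ t c₀ * δV x c)))
      ≈⟨ sumFin-cong (λ t → sumV-cong m (λ x → x∙yz≈xz∙y (G (t ∷ x)) (δ t c₀) (δV x c))) ⟩
    sumFin (λ t → sumV m (λ x → (G (t ∷ x) * δV x c) * δ t c₀))
      ≈⟨ sumFin-cong (λ t → trans (sumV-*ʳ m (δ t c₀) (λ x → G (t ∷ x) * δV x c))
                                  (*-congʳ (siftV m (G ∘ (t ∷_)) c))) ⟩
    sumFin (λ t → G (t ∷ c) * δ t c₀)
      ≈⟨ sift (λ t → G (t ∷ c)) c₀ ⟩
    G (c₀ ∷ c) ∎

  geometric : Carrier → ℕ → Carrier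
  geometric z m = sumFin {m} (λ t → pow z (toℕ t))

  telescope : ∀ z m → z * geometric z m ⊕ 1# ≈ geometric z m ⊕ pow z m
  telescope z zero = +-congʳ (zeroʳ z)
  telescope z (suc m) = begin
    z * (1# ⊕ sumFin {m} (λ t → z * pow z (toℕ t))) ⊕ 1#
      ≈⟨ +-congʳ (*-congˡ (+-congˡ (sumFin-*ˡ {m} z (λ t → pow z (toℕ t))))) ⟩
    z * (1# ⊕ z * G) ⊕ 1#        ≈⟨ telescope-expand z G 1# ⟩
    z * (z * G ⊕ 1#) ⊕ 1#        ≈⟨ +-congʳ (*-congˡ (telescope z m)) ⟩
    z * (G ⊕ pow z m) ⊕ 1#       ≈⟨ telescope-regroup z G (pow z m) 1# ⟩
    (1# ⊕ z * G) ⊕ z * pow z m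
      ≈⟨ +-congʳ (+-congˡ (sym (sumFin-*ˡ {m} z (λ t → pow z (toℕ t))))) ⟩
    (1# ⊕ sumFin {m} (λ t → z * pow z (toℕ t))) ⊕ z * pow z m ∎
    where
    G : Carrier
    G = geometric z m

  geometric-vanishes : NoZeroDivisors → ∀ {z} q → pow z q ≈ 1# → ¬ z ≈ 1# → geometric z q ≈ 0#
  geometric-vanishes noZeroDivisors {z} q zq≈1 z≉1
    with noZeroDivisors (z - 1#) G [z-1]G≈0
    where
    G : Carrier
    G = geometric z q
    zG≈G : z * G ≈ G
    zG≈G = +-cancelʳ 1# (z * G) G (trans (telescope z q) (+-congˡ zq≈1))
    [z-1]G≈0 : (z - 1#) * G ≈ 0#
    [z-1]G≈0 = trans ([y-z]x≈yx-zx G z 1#)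
      (x≈y⇒x∙y⁻¹≈ε (trans zG≈G (sym (*-identityˡ G))))
  ... | inj₁ z-1≈0 = ⊥-elim (z≉1 (x∙y⁻¹≈ε⇒x≈y z 1# z-1≈0))
  ... | inj₂ G≈0 = G≈0

  geometric-trivial : ∀ {z} m → z ≈ 1# → geometric z m ≈ fromℕ m
  geometric-trivial m z≈1 =
    trans (sumFin-cong {m} (λ t → trans (pow-cong (toℕ t) z≈1) (pow-1# (toℕ t)))) (sumFin-1# m)

neg : ∀ {q} → Fin q → Fin q
neg F.zero = F.zero
neg (F.suc i) = F.suc (F.opposite i)

neg-involutive : ∀ {q} (a : Fin q) → neg (neg a) ≡ a
neg-involutive F.zero = P.refl
neg-involutive (F.suc i) = P.cong F.suc (FP.opposite-involutive i)

negV : ∀ {q m} → V q m → V q m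
negV = map neg

negV-involutive : ∀ {q m} (x : V q m) → negV (negV x) ≡ x
negV-involutive [] = P.refl
negV-involutive (a ∷ x) = P.cong₂ _∷_ (neg-involutive a) (negV-involutive x)

neg-suc-sum : ∀ {n} (i : Fin n) → toℕ (F.suc i) + toℕ (neg (F.suc i)) ≡ suc n
neg-suc-sum {n} i = P.cong suc (begin
  toℕ i + suc (toℕ (F.opposite i))  ≡⟨ ℕP.+-suc (toℕ i) _ ⟩
  suc (toℕ i + toℕ (F.opposite i))  ≡⟨ P.cong (λ o → suc (toℕ i + o)) (FP.opposite-prop i) ⟩
  suc (toℕ i + (n ℕ.∸ suc (toℕ i))) ≡⟨ ℕP.m+[n∸m]≡n (FP.toℕ<n i) ⟩
  n ∎)
  where open P.≡-Reasoning

neg-sum : ∀ {n} (a : Fin (suc n)) → toℕ a + toℕ (neg a) ≡ 0 ⊎ toℕ a + toℕ (neg a) ≡ suc n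
neg-sum F.zero = inj₁ P.refl
neg-sum (F.suc i) = inj₂ (neg-suc-sum i)

neg-unique : ∀ {n} (a b : Fin (suc n)) →
  toℕ a + toℕ b ≡ 0 ⊎ toℕ a + toℕ b ≡ suc n → b ≡ neg a
neg-unique F.zero b (inj₁ a+b≡0) = FP.toℕ-injective a+b≡0
neg-unique F.zero b (inj₂ b≡q) = ⊥-elim (ℕP.<-irrefl b≡q (FP.toℕ<n b))
neg-unique (F.suc i) b (inj₂ a+b≡q) =
  FP.toℕ-injective (ℕP.+-cancelˡ-≡ (suc (toℕ i)) _ _ (P.trans a+b≡q (P.sym (neg-suc-sum i))))

-- Walsh analysis over Z_q with q = suc n, for the characters of Defs.
module Walsh {c ℓ} (R : CommutativeRing c ℓ) (n : ℕ) (ζ s sinv : CommutativeRing.Carrier R) where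
  open CommutativeRing R renaming (_+_ to _⊕_)
  open Ring R using (pow; fromℕ; sumFin; sumV; dot; NoZeroDivisors; PrimitiveRoot)
  open Ring.Chars R (suc n) ζ s sinv
  open Algebraic R
  open import Algebra.Properties.CommutativeSemigroup *-commutativeSemigroup
    using (interchange; x∙yz≈xz∙y; xy∙z≈x∙zy; x∙yz≈y∙xz)
  open import Relation.Binary.Reasoning.Setoid setoid

  q : ℕ
  q = suc n

  Q : Carrier
  Q = fromℕ q

  χ̄-+ : ∀ a b → χ̄ (a + b) ≈ χ̄ a * χ̄ b
  χ̄-+ a b = trans (pow-≡ ζ (ℕP.*-distribˡ-+ n a b)) (pow-+ ζ (n ℕ.* a) (n ℕ.* b))

  χ̄-0 : χ̄ 0 ≈ 1#
  χ̄-0 = pow-≡ ζ (ℕP.*-zeroʳ n)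

  dot-++ : ∀ {m k} (u' u : V q m) (v y : V q k) → dot (u' ++ v) (u ++ y) ≡ dot u' u + dot v y
  dot-++ [] [] v y = P.refl
  dot-++ (a ∷ u') (b ∷ u) v y =
    P.trans (P.cong (λ d → toℕ a ℕ.* toℕ b + d) (dot-++ u' u v y)) (P.sym (ℕP.+-assoc (toℕ a ℕ.* toℕ b) _ _))

  -- The unnormalised transform  T F (w) = Σ_u F(u) χ̄(w·u);  by definition
  -- walsh m h = transform m (χ ∘ toℕ ∘ h).
  transform : ∀ m → (V q m → Carrier) → V q m → Carrier
  transform m F w = sumV m (λ u → F u * χ̄ (dot w u))

  transform-scale : ∀ m (F : V q m → Carrier) x w → transform m (λ u → x * F u) w ≈ x * transform m F w
  transform-scale m F x w =
    trans (sumV-cong m (λ u → *-assoc x (F u) _)) (sumV-*ˡ m x (λ u → F u * χ̄ (dot w u)))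

  walsh-split : ∀ m k (f : 𝓕 q (m + k)) u' v →
    walsh (m + k) f (u' ++ v) ≈ transform m (λ u → rect m k f u v) u'
  walsh-split m k f u' v = begin
    walsh (m + k) f (u' ++ v)
      ≈⟨ sumV-++ m k (λ x → χ (toℕ (f x)) * χ̄ (dot (u' ++ v) x)) ⟩
    sumV m (λ u → sumV k (λ y → χ (toℕ (f (u ++ y))) * χ̄ (dot (u' ++ v) (u ++ y))))
      ≈⟨ sumV-cong m (λ u → sumV-cong k (λ y → split-term u y)) ⟩
    sumV m (λ u → sumV k (λ y → (χ (toℕ (f (u ++ y))) * χ̄ (dot v y)) * χ̄ (dot u' u)))
      ≈⟨ sumV-cong m (λ u → sumV-*ʳ k (χ̄ (dot u' u)) (λ y → χ (toℕ (f (u ++ y))) * χ̄ (dot v y))) ⟩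
    transform m (λ u → rect m k f u v) u' ∎
    where
    split-term : ∀ u y → χ (toℕ (f (u ++ y))) * χ̄ (dot (u' ++ v) (u ++ y))
                         ≈ (χ (toℕ (f (u ++ y))) * χ̄ (dot v y)) * χ̄ (dot u' u)
    split-term u y = trans (*-congˡ (trans (pow-≡ ζ (P.cong (n ℕ.*_) (dot-++ u' u v y)))
                                           (χ̄-+ (dot u' u) (dot v y))))
                           (x∙yz≈xz∙y _ _ _)

  module Inversion (noZeroDivisors : NoZeroDivisors) (ζ-primitive : PrimitiveRoot q ζ) where
    ζ^q≈1 : pow ζ q ≈ 1#
    ζ^q≈1 = proj₁ ζ-primitive

    root-of-unity : ∀ e → pow (pow ζ e) q ≈ 1#
    root-of-unity e = begin
      pow (pow ζ e) q ≈⟨ sym (pow-* ζ e q) ⟩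
      pow ζ (e ℕ.* q) ≈⟨ pow-≡ ζ (ℕP.*-comm e q) ⟩
      pow ζ (q ℕ.* e) ≈⟨ pow-* ζ q e ⟩
      pow (pow ζ q) e ≈⟨ pow-cong e ζ^q≈1 ⟩
      pow 1# e        ≈⟨ pow-1# e ⟩
      1#              ∎

    ζ-order : ∀ c → c < q + q → pow ζ c ≈ 1# → c ≡ 0 ⊎ c ≡ q
    ζ-order c c<2q ζ^c≈1 with ℕP.<-cmp c q
    ... | tri< c<q _ _ with c
    ...   | zero = inj₁ P.refl
    ...   | suc c' = ⊥-elim (proj₂ ζ-primitive (suc c') (s≤s z≤n) c<q ζ^c≈1)
    ζ-order c c<2q ζ^c≈1 | tri≈ _ c≡q _ = inj₂ c≡q
    ζ-order c c<2q ζ^c≈1 | tri> _ _ c>q =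
      ⊥-elim (proj₂ ζ-primitive d (ℕP.m<n⇒0<n∸m c>q) d<q ζ^d≈1)
      where
      d : ℕ
      d = c ℕ.∸ q
      d<q : d < q
      d<q = P.subst (d <_) (ℕP.m+n∸m≡n q q) (ℕP.∸-monoˡ-< c<2q (ℕP.<⇒≤ c>q))
      ζ^d≈1 : pow ζ d ≈ 1#
      ζ^d≈1 = begin
        pow ζ d           ≈⟨ sym (*-identityˡ _) ⟩
        1# * pow ζ d      ≈⟨ *-congʳ (sym ζ^q≈1) ⟩
        pow ζ q * pow ζ d ≈⟨ sym (pow-+ ζ q d) ⟩
        pow ζ (q + d)     ≈⟨ pow-≡ ζ (ℕP.m+[n∸m]≡n (ℕP.<⇒≤ c>q)) ⟩
        pow ζ c           ≈⟨ ζ^c≈1 ⟩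
        1#                ∎

    χ̄-trivial : ∀ A → A ≡ 0 ⊎ A ≡ q → χ̄ A ≈ 1#
    χ̄-trivial A (inj₁ A≡0) = trans (pow-≡ ζ (P.cong (n ℕ.*_) A≡0)) χ̄-0
    χ̄-trivial A (inj₂ A≡q) =
      trans (pow-≡ ζ (P.cong (n ℕ.*_) A≡q)) (trans (pow-* ζ n q) (root-of-unity n))

    χ̄-kernel : ∀ A → A < q + q → χ̄ A ≈ 1# → A ≡ 0 ⊎ A ≡ q
    χ̄-kernel A A<2q χ̄A≈1 = ζ-order A A<2q (begin
      pow ζ A             ≈⟨ sym (*-identityʳ _) ⟩
      pow ζ A * 1#        ≈⟨ *-congˡ (sym χ̄A≈1) ⟩
      pow ζ A * χ̄ A       ≈⟨ sym (pow-+ ζ A (n ℕ.* A)) ⟩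
      pow ζ (q ℕ.* A)     ≈⟨ pow-* ζ q A ⟩
      pow (pow ζ q) A     ≈⟨ pow-cong A ζ^q≈1 ⟩
      pow 1# A            ≈⟨ pow-1# A ⟩
      1#                  ∎)

    character-sum : ∀ (a b : Fin q) →
      sumFin {q} (λ t → χ̄ (toℕ a ℕ.* toℕ t) * χ̄ (toℕ t ℕ.* toℕ b)) ≈ Q * δ b (neg a)
    character-sum a b = trans (sumFin-cong {q} as-power) (by-cases (b F.≟ neg a))
      where
      A : ℕ
      A = toℕ a + toℕ b
      as-power : ∀ t → χ̄ (toℕ a ℕ.* toℕ t) * χ̄ (toℕ t ℕ.* toℕ b) ≈ pow (χ̄ A) (toℕ t)
      as-power t = trans (sym (χ̄-+ _ _))
        (trans (pow-≡ ζ (exponent-regroup n (toℕ a) (toℕ t) (toℕ b))) (pow-* ζ (n ℕ.* A) (toℕ t)))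
      by-cases : Dec (b ≡ neg a) → geometric (χ̄ A) q ≈ Q * δ b (neg a)
      by-cases (yes P.refl) = begin
        geometric (χ̄ A) q   ≈⟨ geometric-trivial q (χ̄-trivial A (neg-sum a)) ⟩
        Q                   ≈⟨ sym (*-identityʳ Q) ⟩
        Q * 1#              ≈⟨ *-congˡ (sym (δ-refl (neg a))) ⟩
        Q * δ b (neg a)     ∎
      by-cases (no b≢-a) = begin
        geometric (χ̄ A) q   ≈⟨ geometric-vanishes noZeroDivisors q (root-of-unity (n ℕ.* A)) χ̄A≉1 ⟩
        0#                  ≈⟨ sym (zeroʳ Q) ⟩
        Q * 0#              ≈⟨ *-congˡ (sym (δ-distinct b (neg a) b≢-a)) ⟩
        Q * δ b (neg a)     ∎
        where
        χ̄A≉1 : ¬ χ̄ A ≈ 1#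
        χ̄A≉1 χ̄A≈1 = b≢-a (neg-unique a b
          (χ̄-kernel A (ℕP.+-mono-< (FP.toℕ<n a) (FP.toℕ<n b)) χ̄A≈1))

    orthogonality : ∀ m (w u : V q m) →
      sumV m (λ u' → χ̄ (dot w u') * χ̄ (dot u' u)) ≈ pow Q m * δV u (negV w)
    orthogonality zero [] [] = *-cong χ̄-0 χ̄-0
    orthogonality (suc m) (a ∷ w) (b ∷ u) = begin
      sumFin {q} (λ t → sumV m (λ u' → χ̄ (toℕ a ℕ.* toℕ t + dot w u') * χ̄ (toℕ t ℕ.* toℕ b + dot u' u)))
        ≈⟨ sumFin-cong {q} (λ t → sumV-cong m (λ u' → factor t u')) ⟩
      sumFin {q} (λ t → sumV m (λ u' → B t * C u'))
        ≈⟨ sumFin-cong {q} (λ t → trans (sumV-*ˡ m (B t) C) (*-congˡ (orthogonality m w u))) ⟩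
      sumFin {q} (λ t → B t * (pow Q m * δV u (negV w)))
        ≈⟨ sumFin-*ʳ {q} (pow Q m * δV u (negV w)) B ⟩
      sumFin {q} B * (pow Q m * δV u (negV w))
        ≈⟨ *-congʳ (character-sum a b) ⟩
      (Q * δ b (neg a)) * (pow Q m * δV u (negV w))
        ≈⟨ interchange _ _ _ _ ⟩
      (Q * pow Q m) * (δ b (neg a) * δV u (negV w)) ∎
      where
      B : Fin q → Carrier
      B t = χ̄ (toℕ a ℕ.* toℕ t) * χ̄ (toℕ t ℕ.* toℕ b)
      C : V q m → Carrier
      C u' = χ̄ (dot w u') * χ̄ (dot u' u)
      factor : ∀ t u' → χ̄ (toℕ a ℕ.* toℕ t + dot w u') * χ̄ (toℕ t ℕ.* toℕ b + dot u' u) ≈ B t * C u'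
      factor t u' = trans (*-cong (χ̄-+ _ _) (χ̄-+ _ _)) (interchange _ _ _ _)

    inversion : ∀ m (F : V q m → Carrier) w → transform m (transform m F) w ≈ pow Q m * F (negV w)
    inversion m F w = begin
      sumV m (λ u' → sumV m (λ u → F u * χ̄ (dot u' u)) * χ̄ (dot w u'))
        ≈⟨ sumV-cong m (λ u' → sym (sumV-*ʳ m (χ̄ (dot w u')) (λ u → F u * χ̄ (dot u' u)))) ⟩
      sumV m (λ u' → sumV m (λ u → (F u * χ̄ (dot u' u)) * χ̄ (dot w u')))
        ≈⟨ sumV-comm m m (λ u' u → (F u * χ̄ (dot u' u)) * χ̄ (dot w u')) ⟩
      sumV m (λ u → sumV m (λ u' → (F u * χ̄ (dot u' u)) * χ̄ (dot w u')))
        ≈⟨ sumV-cong m (λ u → trans (sumV-cong m (λ u' → xy∙z≈x∙zy (F u) _ _))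
                                    (sumV-*ˡ m (F u) (λ u' → χ̄ (dot w u') * χ̄ (dot u' u)))) ⟩
      sumV m (λ u → F u * sumV m (λ u' → χ̄ (dot w u') * χ̄ (dot u' u)))
        ≈⟨ sumV-cong m (λ u → *-congˡ (orthogonality m w u)) ⟩
      sumV m (λ u → F u * (pow Q m * δV u (negV w)))
        ≈⟨ sumV-cong m (λ u → trans (sym (*-assoc _ _ _)) (*-congʳ (*-comm (F u) (pow Q m)))) ⟩
      sumV m (λ u → (pow Q m * F u) * δV u (negV w))
        ≈⟨ siftV m (λ u → pow Q m * F u) (negV w) ⟩
      pow Q m * F (negV w) ∎

    transform-injective : ∀ {qinv} → qinv * Q ≈ 1# → ∀ m (F G : V q m → Carrier) →
      (∀ w → transform m F w ≈ transform m G w) → ∀ u → F u ≈ G u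
    transform-injective qinvQ≈1 m F G TF≈TG u = begin
      F u              ≈⟨ reflexive (P.cong F (P.sym (negV-involutive u))) ⟩
      F (negV (negV u)) ≈⟨ unit-cancelˡ (pow-unit m qinvQ≈1) Qᵐ·F≈Qᵐ·G ⟩
      G (negV (negV u)) ≈⟨ reflexive (P.cong G (negV-involutive u)) ⟩
      G u              ∎
      where
      Qᵐ·F≈Qᵐ·G : pow Q m * F (negV (negV u)) ≈ pow Q m * G (negV (negV u))
      Qᵐ·F≈Qᵐ·G = begin
        pow Q m * F (negV (negV u))        ≈⟨ sym (inversion m F (negV u)) ⟩
        transform m (transform m F) (negV u) ≈⟨ sumV-cong m (λ u' → *-congʳ (TF≈TG u')) ⟩
        transform m (transform m G) (negV u) ≈⟨ inversion m G (negV u) ⟩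
        pow Q m * G (negV (negV u))        ∎

  module Normalisation (s²≈q : s * s ≈ Q) (s·sinv≈1 : s * sinv ≈ 1#) where
    sinv·s≈1 : sinv * s ≈ 1#
    sinv·s≈1 = trans (*-comm sinv s) s·sinv≈1

    sinv²·Q≈1 : (sinv * sinv) * Q ≈ 1#
    sinv²·Q≈1 = begin
      (sinv * sinv) * Q        ≈⟨ *-congˡ (sym s²≈q) ⟩
      (sinv * sinv) * (s * s)  ≈⟨ interchange sinv sinv s s ⟩
      (sinv * s) * (sinv * s)  ≈⟨ *-cong sinv·s≈1 sinv·s≈1 ⟩
      1# * 1#                  ≈⟨ *-identityʳ 1# ⟩
      1#                       ∎

    qhalf-⊖ : ∀ m k → qhalf (m ℤ.⊖ k) * pow s k ≈ pow s m
    qhalf-⊖ m zero = *-identityʳ _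
    qhalf-⊖ zero (suc k) = pow-unit (suc k) sinv·s≈1
    qhalf-⊖ (suc m) (suc k) = begin
      qhalf (suc m ℤ.⊖ suc k) * (s * pow s k)
        ≈⟨ *-congʳ (reflexive (P.cong qhalf (ℤP.[1+m]⊖[1+n]≡m⊖n m k))) ⟩
      qhalf (m ℤ.⊖ k) * (s * pow s k)  ≈⟨ x∙yz≈y∙xz _ s _ ⟩
      s * (qhalf (m ℤ.⊖ k) * pow s k)  ≈⟨ *-congˡ (qhalf-⊖ m k) ⟩
      s * pow s m                      ∎

    qhalf-split : ∀ m k → qhalf (+ m ℤ.- + k) * pow s k ≈ pow s m
    qhalf-split m k = trans (*-congʳ (reflexive (P.cong qhalf (ℤP.m-n≡m⊖n m k)))) (qhalf-⊖ m k)

    qhalf-normalises : ∀ m k → qhalf (+ m ℤ.- + k) * pow s (m + k) ≈ pow Q m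
    qhalf-normalises m k = begin
      κ * pow s (m + k)          ≈⟨ *-congˡ (pow-+ s m k) ⟩
      κ * (pow s m * pow s k)    ≈⟨ x∙yz≈xz∙y κ (pow s m) (pow s k) ⟩
      (κ * pow s k) * pow s m    ≈⟨ *-congʳ (qhalf-split m k) ⟩
      pow s m * pow s m          ≈⟨ sym (pow-distrib s s m) ⟩
      pow (s * s) m              ≈⟨ pow-cong m s²≈q ⟩
      pow Q m                    ∎
      where
      κ : Carrier
      κ = qhalf (+ m ℤ.- + k)

    qhalf-unit : ∀ m k → (pow sinv m * pow s k) * qhalf (+ m ℤ.- + k) ≈ 1#
    qhalf-unit m k = begin
      (pow sinv m * pow s k) * κ   ≈⟨ xy∙z≈x∙zy _ _ _ ⟩
      pow sinv m * (κ * pow s k)   ≈⟨ *-congˡ (qhalf-split m k) ⟩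
      pow sinv m * pow s m         ≈⟨ pow-unit m sinv·s≈1 ⟩
      1#                           ∎
      where
      κ : Carrier
      κ = qhalf (+ m ℤ.- + k)

  module Equivalence (noZeroDivisors : NoZeroDivisors) (ζ-primitive : PrimitiveRoot q ζ)
                     (s²≈q : s * s ≈ Q) (s·sinv≈1 : s * sinv ≈ 1#)
                     (m k : ℕ) (f : 𝓕 q (m + k)) where
    open Inversion noZeroDivisors ζ-primitive
    open Normalisation s²≈q s·sinv≈1

    κ : Carrier
    κ = qhalf (+ m ℤ.- + k)

    column : V q k → V q m → Carrier
    column v u = κ * rect m k f u v

    column-transform : ∀ u' v → transform m (column v) u' ≈ κ * walsh (m + k) f (u' ++ v)
    column-transform u' v =
      trans (transform-scale m (λ u → rect m k f u v) κ u') (*-congˡ (sym (walsh-split m k f u' v)))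

    normalised-value : ∀ x → κ * (pow s (m + k) * x) ≈ pow Q m * x
    normalised-value x = trans (sym (*-assoc _ _ _)) (*-congʳ (qhalf-normalises m k))

    -- If f̂(u',v) = q^{(m+k)/2} χ(j(u')), the column at v is the transform
    -- of h = j ∘ negation, detected by comparing transforms.
    forward : RegularBent (m + k) f → RectangleBent m k f
    forward bent v = h , transform-injective sinv²·Q≈1 m (column v) (walsh m h) same-transform
      where
      j : 𝓕 q m
      j u' = proj₁ (bent (u' ++ v))
      h : 𝓕 q m
      h x = j (negV x)
      same-transform : ∀ w → transform m (column v) w ≈ transform m (walsh m h) w
      same-transform w = begin
        transform m (column v) w             ≈⟨ column-transform w v ⟩
        κ * walsh (m + k) f (w ++ v)         ≈⟨ *-congˡ (proj₂ (bent (w ++ v))) ⟩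
        κ * (pow s (m + k) * χ (toℕ (j w)))  ≈⟨ normalised-value _ ⟩
        pow Q m * χ (toℕ (j w))
          ≈⟨ *-congˡ (reflexive (P.cong (λ x → χ (toℕ (j x))) (P.sym (negV-involutive w)))) ⟩
        pow Q m * χ (toℕ (h (negV w)))       ≈⟨ sym (inversion m (λ x → χ (toℕ (h x))) w) ⟩
        transform m (walsh m h) w            ∎

    -- If the column at v is ĥ, inverting the transform gives
    -- f̂(u',v) = q^{(m+k)/2} χ(h(-u')).
    backward : RectangleBent m k f → RegularBent (m + k) f
    backward rectangle-bent w with splitAt m w
    ... | u' , v , P.refl = h (negV u') , unit-cancelˡ (qhalf-unit m k) κ·f̂≈κ·value
      where
      h : 𝓕 q m
      h = proj₁ (rectangle-bent v)
      κ·f̂≈κ·value : κ * walsh (m + k) f (u' ++ v) ≈ κ * (pow s (m + k) * χ (toℕ (h (negV u'))))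
      κ·f̂≈κ·value = begin
        κ * walsh (m + k) f (u' ++ v)    ≈⟨ sym (column-transform u' v) ⟩
        transform m (column v) u'        ≈⟨ sumV-cong m (λ u → *-congʳ (proj₂ (rectangle-bent v) u)) ⟩
        transform m (walsh m h) u'       ≈⟨ inversion m (λ x → χ (toℕ (h x))) u' ⟩
        pow Q m * χ (toℕ (h (negV u')))  ≈⟨ sym (normalised-value _) ⟩
        κ * (pow s (m + k) * χ (toℕ (h (negV u')))) ∎

proposition1 : ∀ {c ℓ} (R : CommutativeRing c ℓ) (q : ℕ) → 2 ≤ q →
    (ζ s sinv : CommutativeRing.Carrier R) →
    Ring.NoZeroDivisors R →
    Ring.PrimitiveRoot R q ζ →
    CommutativeRing._≈_ R (CommutativeRing._*_ R s s) (Ring.fromℕ R q) →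
    CommutativeRing._≈_ R (CommutativeRing._*_ R s sinv) (CommutativeRing.1# R) →
    (m k : ℕ) (f : 𝓕 q (m + k)) →
    Ring.Chars.RegularBent R q ζ s sinv (m + k) f ⇔ Ring.Chars.RectangleBent R q ζ s sinv m k f
proposition1 R zero () ζ s sinv
proposition1 R (suc n) _ ζ s sinv noZeroDivisors ζ-primitive s²≈q s·sinv≈1 m k f =
  mk⇔ forward backward
  where open Walsh.Equivalence R n ζ s sinv noZeroDivisors ζ-primitive s²≈q s·sinv≈1 m k f
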